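{- For any graph $G$, $\chi'(G^{\odot}) = \chi'(G)$.
   Context: A graph has finite vertex and edge sets; every edge is a normal edge (two distinct end-vertices, adding 1 to each degree), a loop (one vertex, adding 2 to its degree) or a semi-edge (one vertex, adding 1 to its degree); multiple loops, semi-edges and parallel edges are allowed. A proper edge coloring of $G$ is a map $f:E(G)\to C$ such that for each color $c$, the spanning subgraph formed by the edges of color $c$ has maximum degree at most 1 (semi-edges contribute 1, loops 2). $\chi'(G)$ is the minimum $|C|$ over proper edge colorings, and $\chi'(G)=\infty$ if no proper edge coloring exists (i.e. when $G$ has a loop). $G^{\odot}$ has vertex set $\{v_0,v_1: v\in V(G)\}$; each normal edge $e=uv$ gives edges $e_0$ joining $u_0,v_0$ and $e_1$ joining $u_1,v_1$; each loop $e$ at $v$ gives a loop at $v_0$ and a loop at $v_1$; each semi-edge $e$ at $v$ gives one normal edge $\tilde e$ joining $v_0,v_1$. -}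

module Defs where

open import Data.Nat using (ℕ; zero; suc; _+_; _≤_; _<_)
open import Data.Nat.Properties using (m+n≮m)
open import Data.Fin using (Fin; toℕ; _↑ˡ_; _↑ʳ_; _≟_)
open import Data.Fin.Properties using (↑ˡ-injective; ↑ʳ-injective; toℕ-↑ˡ; toℕ-↑ʳ; toℕ<n)
open import Data.List using (List; []; _∷_; _++_; length; map; allFin)
open import Data.Nat.ListAction using (sum)
open import Data.Maybe using (Maybe; just; nothing)
open import Data.Product using (_×_; Σ)
open import Relation.Nullary using (¬_; yes; no)
open import Relation.Binary.PropositionalEquality using (_≡_; _≢_; refl; cong; sym; trans; subst)

data Edge (n : ℕ) : Set where
  normal : (u v : Fin n) → u ≢ v → Edge n
  loop   : (v : Fin n) → Edge n               -- adds 2 to the degree of v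
  semi   : (v : Fin n) → Edge n               -- adds 1 to the degree of v

-- A graph: finite vertex set Fin n, finite edge set given as a list of edges
-- (edges are identified by their position, so parallel edges, multiple loops
-- and multiple semi-edges are allowed).
record Graph : Set where
  constructor graph
  field
    nV    : ℕ
    edges : List (Edge nV)
open Graph public

δ : {n : ℕ} → Fin n → Edge n → ℕ
δ x (normal u v _) with x ≟ u | x ≟ v
... | yes _ | _     = 1
... | no _  | yes _ = 1
... | no _  | no _  = 0
δ x (loop v) with x ≟ v
... | yes _ = 2
... | no _  = 0
δ x (semi v) with x ≟ v
... | yes _ = 1
... | no _  = 0

EdgeId : Graph → Set
EdgeId G = Fin (length (edges G))

edgeAt : (G : Graph) → EdgeId G → Edge (nV G)
edgeAt G i = Data.List.lookup (edges G) i

colorDeg : (G : Graph) {k : ℕ} → (EdgeId G → Fin k) → Fin k → Fin (nV G) → ℕ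
colorDeg G f c x = sum (map contrib (allFin (length (edges G))))
  where
    contrib : EdgeId G → ℕ
    contrib i with f i ≟ c
    ... | yes _ = δ x (edgeAt G i)
    ... | no _  = 0

IsProperEdgeColoring : (G : Graph) (k : ℕ) → (EdgeId G → Fin k) → Set
IsProperEdgeColoring G k f = (c : Fin k) (x : Fin (nV G)) → colorDeg G f c x ≤ 1

Colorable : Graph → ℕ → Set
Colorable G k = Σ (EdgeId G → Fin k) (IsProperEdgeColoring G k)

-- χ'(G) has value x : Maybe ℕ, where 'nothing' stands for ∞:
--   just k  : G has a proper coloring with k colors and none with fewer;
--   nothing : G has no proper edge coloring with any finite number of colors.
ChromaticIndexIs : Graph → Maybe ℕ → Set
ChromaticIndexIs G (just k) = Colorable G k × ((j : ℕ) → j < k → ¬ Colorable G j)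
ChromaticIndexIs G nothing  = (k : ℕ) → ¬ Colorable G k

-- The doubled graph G^⊙ : vertex v₀ is v ↑ˡ n, vertex v₁ is n ↑ʳ v.
v0≢v1 : {n : ℕ} (v : Fin n) → (v ↑ˡ n) ≢ (n ↑ʳ v)
v0≢v1 {n} v eq = m+n≮m n (toℕ v)
  (subst (λ t → t < n) (trans (sym (toℕ-↑ˡ v n)) (trans (cong toℕ eq) (toℕ-↑ʳ n v))) (toℕ<n v))

doubleEdge : {n : ℕ} → Edge n → List (Edge (n + n))
doubleEdge {n} (normal u v u≢v) =
  normal (u ↑ˡ n) (v ↑ˡ n) (λ eq → u≢v (↑ˡ-injective n u v eq)) ∷
  normal (n ↑ʳ u) (n ↑ʳ v) (λ eq → u≢v (↑ʳ-injective n u v eq)) ∷ []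
doubleEdge {n} (loop v) = loop (v ↑ˡ n) ∷ loop (n ↑ʳ v) ∷ []
doubleEdge {n} (semi v) = normal (v ↑ˡ n) (n ↑ʳ v) (v0≢v1 v) ∷ []

doubleEdges : {n : ℕ} → List (Edge n) → List (Edge (n + n))
doubleEdges []       = []
doubleEdges (e ∷ es) = doubleEdge e ++ doubleEdges es

double : Graph → Graph
double G = graph (nV G + nV G) (doubleEdges (edges G))

{-# OPTIONS --safe #-}

-- Giving every copy in G^⊙ the colour of its original edge of G is proper: the edges at v₀
-- (and at v₁) are copies of the edges at v, one copy each and with the same multiplicity.
-- Conversely, colouring each edge of G like its copy at the 0-side (e₀, or ẽ for a
-- semi-edge) is proper, since the colour-c degree of v is at most that of v₀. So G and G^⊙
-- are colourable with exactly the same numbers of colours, which determines χ'.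

module Submission where

open import Defs
open import Data.Empty using (⊥-elim)
open import Data.Fin using (Fin; zero; suc; _≟_; _↑ˡ_; _↑ʳ_; splitAt; join)
open import Data.Fin.Properties using (↑ˡ-injective; ↑ʳ-injective; splitAt-↑ˡ; splitAt-↑ʳ; join-splitAt)
open import Data.List using (List; []; _∷_; foldr; length; lookup; map; tabulate)
open import Data.List.Properties using (map-tabulate; tabulate-cong)
open import Data.Maybe using (Maybe; just; nothing)
open import Data.Nat using (ℕ; _+_; _≤_; z≤n)
open import Data.Nat.ListAction using (sum)
open import Data.Nat.Properties using (+-assoc; +-identityʳ; +-mono-≤; m≤n+m; ≤-trans; ≤-reflexive; module ≤-Reasoning)
open import Data.Product using (Σ; _,_; proj₁; proj₂)
open import Data.Sum using ([_,_])
open import Function using (_∘_; id)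
open import Function.Bundles using (_⇔_; mk⇔; Equivalence)
open import Function.Definitions using (Injective)
open import Relation.Nullary using (yes; no)
open import Relation.Binary.PropositionalEquality using (_≡_; _≢_; refl; sym; trans; cong; cong₂; subst; module ≡-Reasoning)

ChromaticIndexIs-cong : {G H : Graph} → (∀ k → Colorable G k ⇔ Colorable H k) →
                        ∀ x → ChromaticIndexIs G x ⇔ ChromaticIndexIs H x
ChromaticIndexIs-cong G⇔H (just k) = mk⇔
  (λ (col , minimal) → to (G⇔H k) col , λ j j<k → minimal j j<k ∘ from (G⇔H j))
  (λ (col , minimal) → from (G⇔H k) col , λ j j<k → minimal j j<k ∘ to (G⇔H j))
  where open Equivalence
ChromaticIndexIs-cong G⇔H nothing = mk⇔
  (λ none k → none k ∘ from (G⇔H k))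
  (λ none k → none k ∘ to (G⇔H k))
  where open Equivalence

ifColor : {k : ℕ} → Fin k → Fin k → ℕ → ℕ
ifColor a c d with a ≟ c
... | yes _ = d
... | no _  = 0

module _ {k : ℕ} (a c : Fin k) where

  ifColor-zero : ifColor a c 0 ≡ 0
  ifColor-zero with a ≟ c
  ... | yes _ = refl
  ... | no _  = refl

  ifColor-+ : ∀ m n → ifColor a c (m + n) ≡ ifColor a c m + ifColor a c n
  ifColor-+ m n with a ≟ c
  ... | yes _ = refl
  ... | no _  = refl

  foldr-ifColor : ∀ ds r → foldr (λ d → ifColor a c d +_) r ds ≡ ifColor a c (sum ds) + r
  foldr-ifColor []       r = cong (_+ r) (sym ifColor-zero)
  foldr-ifColor (d ∷ ds) r = begin
    ifColor a c d + foldr (λ d → ifColor a c d +_) r ds  ≡⟨ cong (ifColor a c d +_) (foldr-ifColor ds r) ⟩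
    ifColor a c d + (ifColor a c (sum ds) + r)           ≡⟨ +-assoc (ifColor a c d) _ r ⟨
    ifColor a c d + ifColor a c (sum ds) + r             ≡⟨ cong (_+ r) (ifColor-+ d (sum ds)) ⟨
    ifColor a c (d + sum ds) + r                         ∎
    where open ≡-Reasoning

colorDegOf : {n k : ℕ} (es : List (Edge n)) → (Fin (length es) → Fin k) → Fin k → Fin n → ℕ
colorDegOf []       f c x = 0
colorDegOf (e ∷ es) f c x = ifColor (f zero) c (δ x e) + colorDegOf es (f ∘ suc) c x

-- The summand of colorDeg is local to its where block; unification recovers it.
colorDeg-summand : (G : Graph) {k : ℕ} (f : EdgeId G → Fin k) (c : Fin k) (x : Fin (nV G)) →
                   Σ (EdgeId G → ℕ) λ h → colorDeg G f c x ≡ sum (map h (tabulate id))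
colorDeg-summand G f c x = _ , refl

colorDeg-summand-ifColor : (G : Graph) {k : ℕ} (f : EdgeId G → Fin k) (c : Fin k) (x : Fin (nV G)) →
                           ∀ i → proj₁ (colorDeg-summand G f c x) i ≡ ifColor (f i) c (δ x (edgeAt G i))
colorDeg-summand-ifColor G f c x i with f i ≟ c
... | yes _ = refl
... | no _  = refl

sum-tabulate-ifColor : {n k : ℕ} (es : List (Edge n)) (f : Fin (length es) → Fin k)
                       (c : Fin k) (x : Fin n) →
                       sum (tabulate (λ i → ifColor (f i) c (δ x (lookup es i)))) ≡ colorDegOf es f c x
sum-tabulate-ifColor []       f c x = refl
sum-tabulate-ifColor (e ∷ es) f c x =
  cong (ifColor (f zero) c (δ x e) +_) (sum-tabulate-ifColor es (f ∘ suc) c x)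

colorDeg≡colorDegOf : (G : Graph) {k : ℕ} (f : EdgeId G → Fin k) (c : Fin k) (x : Fin (nV G)) →
                      colorDeg G f c x ≡ colorDegOf (edges G) f c x
colorDeg≡colorDegOf G f c x = begin
  colorDeg G f c x
    ≡⟨ proj₂ (colorDeg-summand G f c x) ⟩
  sum (map summand (tabulate id))
    ≡⟨ cong sum (map-tabulate id summand) ⟩
  sum (tabulate summand)
    ≡⟨ cong sum (tabulate-cong (colorDeg-summand-ifColor G f c x)) ⟩
  sum (tabulate (λ i → ifColor (f i) c (δ x (edgeAt G i))))
    ≡⟨ sum-tabulate-ifColor (edges G) f c x ⟩
  colorDegOf (edges G) f c x
    ∎
  where
  open ≡-Reasoning
  summand : EdgeId G → ℕ
  summand = proj₁ (colorDeg-summand G f c x)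

module _ {m n : ℕ} {ι : Fin m → Fin n} (ι-injective : Injective _≡_ _≡_ ι) where

  δ-image-normal : ∀ x u v (p : ι u ≢ ι v) (q : u ≢ v) → δ (ι x) (normal (ι u) (ι v) p) ≡ δ x (normal u v q)
  δ-image-normal x u v p q with ι x ≟ ι u | x ≟ u | ι x ≟ ι v | x ≟ v
  ... | yes _  | yes _  | _      | _      = refl
  ... | yes eq | no neq | _      | _      = ⊥-elim (neq (ι-injective eq))
  ... | no neq | yes eq | _      | _      = ⊥-elim (neq (cong ι eq))
  ... | no _   | no _   | yes _  | yes _  = refl
  ... | no _   | no _   | yes eq | no neq = ⊥-elim (neq (ι-injective eq))
  ... | no _   | no _   | no neq | yes eq = ⊥-elim (neq (cong ι eq))
  ... | no _   | no _   | no _   | no _   = refl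

  δ-image-loop : ∀ x v → δ (ι x) (loop (ι v)) ≡ δ x (loop v)
  δ-image-loop x v with ι x ≟ ι v | x ≟ v
  ... | yes _  | yes _  = refl
  ... | yes eq | no neq = ⊥-elim (neq (ι-injective eq))
  ... | no neq | yes eq = ⊥-elim (neq (cong ι eq))
  ... | no _   | no _   = refl

  δ-image-normalˡ : ∀ x w z (p : ι w ≢ z) → ι x ≢ z → δ (ι x) (normal (ι w) z p) ≡ δ x (semi w)
  δ-image-normalˡ x w z p ιx≢z with ι x ≟ ι w | x ≟ w | ι x ≟ z
  ... | yes _  | yes _  | _      = refl
  ... | yes eq | no neq | _      = ⊥-elim (neq (ι-injective eq))
  ... | no neq | yes eq | _      = ⊥-elim (neq (cong ι eq))
  ... | no _   | no _   | yes eq = ⊥-elim (ιx≢z eq)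
  ... | no _   | no _   | no _   = refl

  δ-image-normalʳ : ∀ x w z (p : z ≢ ι w) → ι x ≢ z → δ (ι x) (normal z (ι w) p) ≡ δ x (semi w)
  δ-image-normalʳ x w z p ιx≢z with ι x ≟ z | ι x ≟ ι w | x ≟ w
  ... | yes eq | _      | _      = ⊥-elim (ιx≢z eq)
  ... | no _   | yes _  | yes _  = refl
  ... | no _   | yes eq | no neq = ⊥-elim (neq (ι-injective eq))
  ... | no _   | no neq | yes eq = ⊥-elim (neq (cong ι eq))
  ... | no _   | no _   | no _   = refl

δ-normal-≢ : {n : ℕ} {y u v : Fin n} {p : u ≢ v} → y ≢ u → y ≢ v → δ y (normal u v p) ≡ 0
δ-normal-≢ {y = y} {u} {v} y≢u y≢v with y ≟ u | y ≟ v
... | yes eq | _      = ⊥-elim (y≢u eq)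
... | no _   | yes eq = ⊥-elim (y≢v eq)
... | no _   | no _   = refl

δ-loop-≢ : {n : ℕ} {y v : Fin n} → y ≢ v → δ y (loop v) ≡ 0
δ-loop-≢ {y = y} {v} y≢v with y ≟ v
... | yes eq = ⊥-elim (y≢v eq)
... | no _   = refl

↑-elim : {m n : ℕ} (P : Fin (m + n) → Set) → (∀ i → P (i ↑ˡ n)) → (∀ j → P (m ↑ʳ j)) → ∀ k → P k
↑-elim {m} {n} P left right k =
  subst P (join-splitAt m n k) ([_,_] {C = P ∘ join m n} left right (splitAt m k))

module _ {n : ℕ} where

  ↑ˡ-inj : Injective (_≡_ {A = Fin n}) _≡_ (_↑ˡ n)
  ↑ˡ-inj = ↑ˡ-injective n _ _

  ↑ʳ-inj : Injective (_≡_ {A = Fin n}) _≡_ (n ↑ʳ_)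
  ↑ʳ-inj = ↑ʳ-injective n _ _

  ↑ˡ≢↑ʳ : (x y : Fin n) → x ↑ˡ n ≢ n ↑ʳ y
  ↑ˡ≢↑ʳ x y eq with trans (sym (splitAt-↑ˡ n x n)) (trans (cong (splitAt n) eq) (splitAt-↑ʳ n n y))
  ... | ()

  δ-copies-↑ˡ : (x : Fin n) (e : Edge n) → sum (map (δ (x ↑ˡ n)) (doubleEdge e)) ≡ δ x e
  δ-copies-↑ˡ x (normal u v p) = trans
    (cong₂ _+_ (δ-image-normal ↑ˡ-inj x u v (p ∘ ↑ˡ-inj) p)
               (cong (_+ 0) (δ-normal-≢ {p = p ∘ ↑ʳ-inj} (↑ˡ≢↑ʳ x u) (↑ˡ≢↑ʳ x v))))
    (+-identityʳ _)
  δ-copies-↑ˡ x (loop v) = trans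
    (cong₂ _+_ (δ-image-loop ↑ˡ-inj x v) (cong (_+ 0) (δ-loop-≢ (↑ˡ≢↑ʳ x v))))
    (+-identityʳ _)
  δ-copies-↑ˡ x (semi w) = trans
    (cong (_+ 0) (δ-image-normalˡ ↑ˡ-inj x w (n ↑ʳ w) (v0≢v1 w) (↑ˡ≢↑ʳ x w)))
    (+-identityʳ _)

  δ-copies-↑ʳ : (x : Fin n) (e : Edge n) → sum (map (δ (n ↑ʳ x)) (doubleEdge e)) ≡ δ x e
  δ-copies-↑ʳ x (normal u v p) =
    cong₂ _+_ (δ-normal-≢ {p = p ∘ ↑ˡ-inj} (↑ˡ≢↑ʳ u x ∘ sym) (↑ˡ≢↑ʳ v x ∘ sym))
              (trans (+-identityʳ _) (δ-image-normal ↑ʳ-inj x u v (p ∘ ↑ʳ-inj) p))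
  δ-copies-↑ʳ x (loop v) =
    cong₂ _+_ (δ-loop-≢ (↑ˡ≢↑ʳ v x ∘ sym)) (trans (+-identityʳ _) (δ-image-loop ↑ʳ-inj x v))
  δ-copies-↑ʳ x (semi w) =
    trans (+-identityʳ _) (δ-image-normalʳ ↑ʳ-inj x w (w ↑ˡ n) (v0≢v1 w) (↑ˡ≢↑ʳ w x ∘ sym))

  origin : (es : List (Edge n)) → Fin (length (doubleEdges es)) → Fin (length es)
  origin (normal _ _ _ ∷ es) zero          = zero
  origin (normal _ _ _ ∷ es) (suc zero)    = zero
  origin (normal _ _ _ ∷ es) (suc (suc j)) = suc (origin es j)
  origin (loop _ ∷ es)       zero          = zero
  origin (loop _ ∷ es)       (suc zero)    = zero
  origin (loop _ ∷ es)       (suc (suc j)) = suc (origin es j)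
  origin (semi _ ∷ es)       zero          = zero
  origin (semi _ ∷ es)       (suc j)       = suc (origin es j)

  -- e₀ for a normal edge or loop, ẽ for a semi-edge
  firstCopy : (es : List (Edge n)) → Fin (length es) → Fin (length (doubleEdges es))
  firstCopy (normal _ _ _ ∷ es) zero    = zero
  firstCopy (normal _ _ _ ∷ es) (suc i) = suc (suc (firstCopy es i))
  firstCopy (loop _ ∷ es)       zero    = zero
  firstCopy (loop _ ∷ es)       (suc i) = suc (suc (firstCopy es i))
  firstCopy (semi _ ∷ es)       zero    = zero
  firstCopy (semi _ ∷ es)       (suc i) = suc (firstCopy es i)

  colorDegOf-double-∷ : {k : ℕ} (e : Edge n) (es : List (Edge n)) (f : Fin (length (e ∷ es)) → Fin k)
                        (c : Fin k) (y : Fin (n + n)) →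
                        colorDegOf (doubleEdges (e ∷ es)) (f ∘ origin (e ∷ es)) c y ≡
                        foldr (λ d → ifColor (f zero) c d +_)
                              (colorDegOf (doubleEdges es) (f ∘ suc ∘ origin es) c y)
                              (map (δ y) (doubleEdge e))
  colorDegOf-double-∷ (normal _ _ _) es f c y = refl
  colorDegOf-double-∷ (loop _)       es f c y = refl
  colorDegOf-double-∷ (semi _)       es f c y = refl

  colorDegOf-double : {k : ℕ} {y : Fin (n + n)} {x : Fin n} →
                      (∀ e → sum (map (δ y) (doubleEdge e)) ≡ δ x e) →
                      ∀ es (f : Fin (length es) → Fin k) c →
                      colorDegOf (doubleEdges es) (f ∘ origin es) c y ≡ colorDegOf es f c x
  colorDegOf-double                 copies []       f c = refl
  colorDegOf-double {y = y} {x} copies (e ∷ es) f c = begin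
    colorDegOf (doubleEdges (e ∷ es)) (f ∘ origin (e ∷ es)) c y
      ≡⟨ colorDegOf-double-∷ e es f c y ⟩
    foldr (λ d → ifColor (f zero) c d +_) (colorDegOf (doubleEdges es) (f ∘ suc ∘ origin es) c y)
          (map (δ y) (doubleEdge e))
      ≡⟨ foldr-ifColor (f zero) c (map (δ y) (doubleEdge e)) _ ⟩
    ifColor (f zero) c (sum (map (δ y) (doubleEdge e)))
      + colorDegOf (doubleEdges es) (f ∘ suc ∘ origin es) c y
      ≡⟨ cong₂ _+_ (cong (ifColor (f zero) c) (copies e)) (colorDegOf-double copies es (f ∘ suc) c) ⟩
    ifColor (f zero) c (δ x e) + colorDegOf es (f ∘ suc) c x
      ∎
    where open ≡-Reasoning

  colorDegOf-firstCopy : {k : ℕ} (es : List (Edge n)) (g : Fin (length (doubleEdges es)) → Fin k)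
                         (c : Fin k) (x : Fin n) →
                         colorDegOf es (g ∘ firstCopy es) c x ≤ colorDegOf (doubleEdges es) g c (x ↑ˡ n)
  colorDegOf-firstCopy [] g c x = z≤n
  colorDegOf-firstCopy (normal u v p ∷ es) g c x =
    +-mono-≤ (≤-reflexive (cong (ifColor (g zero) c) (sym (δ-image-normal ↑ˡ-inj x u v (p ∘ ↑ˡ-inj) p))))
             (≤-trans (colorDegOf-firstCopy es (g ∘ suc ∘ suc) c x) (m≤n+m _ _))
  colorDegOf-firstCopy (loop v ∷ es) g c x =
    +-mono-≤ (≤-reflexive (cong (ifColor (g zero) c) (sym (δ-image-loop ↑ˡ-inj x v))))
             (≤-trans (colorDegOf-firstCopy es (g ∘ suc ∘ suc) c x) (m≤n+m _ _))
  colorDegOf-firstCopy (semi w ∷ es) g c x =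
    +-mono-≤ (≤-reflexive (cong (ifColor (g zero) c)
                                (sym (δ-image-normalˡ ↑ˡ-inj x w (n ↑ʳ w) (v0≢v1 w) (↑ˡ≢↑ʳ x w)))))
             (colorDegOf-firstCopy es (g ∘ suc) c x)

Colorable-double⁺ : {G : Graph} {k : ℕ} → Colorable G k → Colorable (double G) k
Colorable-double⁺ {G} (f , proper) = f ∘ origin es , λ c →
  ↑-elim _ (λ x → colorDeg≤1 c (δ-copies-↑ˡ x)) (λ x → colorDeg≤1 c (δ-copies-↑ʳ x))
  where
  open ≤-Reasoning
  es : List (Edge (nV G))
  es = edges G
  colorDeg≤1 : ∀ c {y x} → (∀ e → sum (map (δ y) (doubleEdge e)) ≡ δ x e) →
               colorDeg (double G) (f ∘ origin es) c y ≤ 1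
  colorDeg≤1 c {y} {x} copies = begin
    colorDeg (double G) (f ∘ origin es) c y          ≡⟨ colorDeg≡colorDegOf (double G) (f ∘ origin es) c y ⟩
    colorDegOf (doubleEdges es) (f ∘ origin es) c y  ≡⟨ colorDegOf-double copies es f c ⟩
    colorDegOf es f c x                              ≡⟨ colorDeg≡colorDegOf G f c x ⟨
    colorDeg G f c x                                 ≤⟨ proper c x ⟩
    1                                                ∎

Colorable-double⁻ : {G : Graph} {k : ℕ} → Colorable (double G) k → Colorable G k
Colorable-double⁻ {G} (g , proper) = g ∘ firstCopy es , λ c x → begin
  colorDeg G (g ∘ firstCopy es) c x                ≡⟨ colorDeg≡colorDegOf G (g ∘ firstCopy es) c x ⟩
  colorDegOf es (g ∘ firstCopy es) c x             ≤⟨ colorDegOf-firstCopy es g c x ⟩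
  colorDegOf (doubleEdges es) g c (x ↑ˡ nV G)      ≡⟨ colorDeg≡colorDegOf (double G) g c (x ↑ˡ nV G) ⟨
  colorDeg (double G) g c (x ↑ˡ nV G)              ≤⟨ proper c (x ↑ˡ nV G) ⟩
  1                                                ∎
  where
  open ≤-Reasoning
  es : List (Edge (nV G))
  es = edges G

lemma1 : (G : Graph) (x : Maybe ℕ) → ChromaticIndexIs (double G) x ⇔ ChromaticIndexIs G x
lemma1 G = ChromaticIndexIs-cong (λ k → mk⇔ (Colorable-double⁻ {G}) (Colorable-double⁺ {G}))
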